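{- Let $\alpha$ be a composition of $n$, $E\in\mathcal E(\alpha)$ and $T_0=T_{0,E}$ its source tableau. Let $i\in D(T_0)$ and set $j=\min\{k\in[n]: k>i \text{ and } i \text{ attacks } k \text{ in } T_0\}$. Then $j$ is well defined, and in $T_0$ the entry $i$ is located strictly left of every entry of $[i+1,j-1]$ (i.e. $c_{T_0}(i)<c_{T_0}(k)$ for all $k\in[i+1,j-1]$) and $i$ attacks no entry of $[i+1,j-1]$.
   Context: A composition $\alpha=(\alpha_1,\dots,\alpha_l)$ of $n$ has diagram $\{(i,j):i\le l,j\le\alpha_i\}$ (matrix coordinates, row 1 on top). An SCT of shape $\alpha$ is a bijection $T$ from the diagram to $[n]$ with rows decreasing left to right, first column increasing top to bottom, and the triple rule: if $(j,k),(i,k-1)\in\alpha$, $j>i$, $T(j,k)<T(i,k-1)$, then $(i,k)\in\alpha$ and $T(j,k)<T(i,k)$. Let $c_T(k)$ be the column of $T^{ -1}(k)$ and $D(T)=\{i\in[n-1]:c_T(i)\le c_T(i+1)\}$. A cell $(i,j)$ attacks $(i',j')$ if $j=j'$ and $i\ne i'$, or $j=j'-1$ and $i<i'$; entry $a$ attacks $b$ in $T$ if $T^{ -1}(a)$ attacks $T^{ -1}(b)$. $[a,b]=\{c\in\mathbb Z:a\le c\le b\}$. $T_1\sim T_2$ iff in each column the relative orders of entries coincide; $\mathcal E(\alpha)$ is the set of equivalence classes. The source tableau $T_{0,E}$ of $E$ is the unique $T\in E$ such that for every $i\in[n-1]\setminus D(T)$ the cell of $i+1$ is immediately to the left of the cell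 of $i$ in the same row. -}

module Defs where

open import Data.Nat using (ℕ; zero; suc; _+_; _∸_; _≤_; _<_)
open import Data.List using (List; []; _∷_; length)
open import Data.Nat.ListAction using (sum)
open import Data.List.Relation.Unary.All using (All)
open import Data.Product using (_×_; ∃-syntax)
open import Data.Sum using (_⊎_)
open import Relation.Binary.PropositionalEquality using (_≡_; _≢_)
open import Relation.Nullary using (¬_)

IsComposition : ℕ → List ℕ → Set
IsComposition n α = All (λ a → 0 < a) α × sum α ≡ n

-- Length of row r (1-indexed); 0 outside the range of rows.
rowLen : List ℕ → ℕ → ℕ
rowLen []       _             = 0
rowLen (_ ∷ _)  zero          = 0
rowLen (a ∷ _)  (suc zero)    = a
rowLen (_ ∷ as) (suc (suc r)) = rowLen as (suc r)

-- Cell (r , c) (row r, column c, 1-indexed, matrix coordinates) lies in the diagram.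
InDiag : List ℕ → ℕ → ℕ → Set
InDiag α r c = 1 ≤ r × r ≤ length α × 1 ≤ c × c ≤ rowLen α r

Tab : Set
Tab = ℕ → ℕ → ℕ

IsBijection : ℕ → List ℕ → Tab → Set
IsBijection n α T =
  (∀ r c → InDiag α r c → 1 ≤ T r c × T r c ≤ n)
  × (∀ r c r' c' → InDiag α r c → InDiag α r' c' → T r c ≡ T r' c' → r ≡ r' × c ≡ c')
  × (∀ k → 1 ≤ k → k ≤ n → ∃[ r ] ∃[ c ] (InDiag α r c × T r c ≡ k))

IsSCT : ℕ → List ℕ → Tab → Set
IsSCT n α T =
  IsBijection n α T
  × (∀ r c → InDiag α r c → InDiag α r (suc c) → T r (suc c) < T r c)
  × (∀ r r' → InDiag α r 1 → InDiag α r' 1 → r < r' → T r 1 < T r' 1)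
  -- triple rule (k = suc c, columns k and k-1 = c)
  × (∀ i j c → InDiag α j (suc c) → InDiag α i c → i < j → T j (suc c) < T i c
       → InDiag α i (suc c) × T j (suc c) < T i (suc c))

Pos : List ℕ → Tab → ℕ → ℕ → ℕ → Set
Pos α T k r c = InDiag α r c × T r c ≡ k

InD : ℕ → List ℕ → Tab → ℕ → Set
InD n α T i = 1 ≤ i × i ≤ n ∸ 1 ×
  ∃[ r ] ∃[ c ] ∃[ r' ] ∃[ c' ] (Pos α T i r c × Pos α T (suc i) r' c' × c ≤ c')

CellAttacks : ℕ → ℕ → ℕ → ℕ → Set
CellAttacks r c r' c' = (c ≡ c' × r ≢ r') ⊎ (suc c ≡ c' × r < r')

Attacks : List ℕ → Tab → ℕ → ℕ → Set
Attacks α T a b = ∃[ r ] ∃[ c ] ∃[ r' ] ∃[ c' ]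
  (Pos α T a r c × Pos α T b r' c' × CellAttacks r c r' c')

ColLt : List ℕ → Tab → ℕ → ℕ → Set
ColLt α T a b = ∀ r c r' c' → Pos α T a r c → Pos α T b r' c' → c < c'

Equiv : List ℕ → Tab → Tab → Set
Equiv α T₁ T₂ = ∀ r r' c → InDiag α r c → InDiag α r' c →
  (T₁ r c < T₁ r' c → T₂ r c < T₂ r' c) × (T₂ r c < T₂ r' c → T₁ r c < T₁ r' c)

SourceProp : ℕ → List ℕ → Tab → Set
SourceProp n α T = ∀ i → 1 ≤ i → i ≤ n ∸ 1 → ¬ InD n α T i →
  ∃[ r ] ∃[ c ] (Pos α T (suc i) r c × Pos α T i r (suc c))

module Submission where

open import Defs
open import Data.Nat using (ℕ; zero; suc; _≤_; _<_; _≟_; _<?_; _≤?_)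
open import Data.Nat.Properties
open import Data.List using (List)
open import Data.Product using (_×_; _,_; proj₁; proj₂; ∃-syntax)
open import Function using (_∘_)
open import Data.Sum using (_⊎_; inj₁; inj₂)
open import Relation.Nullary using (¬_; Dec; yes; no; ¬?; contradiction)
open import Relation.Nullary.Decidable using (_×-dec_; _⊎-dec_)
open import Relation.Unary using (Pred; Decidable)
open import Relation.Binary.PropositionalEquality

-- Since i ∈ D(T₀), i attacks some larger entry (i+1 itself, or the entry
-- in the column of i and the row of i+1), so a least such j exists. Walking up
-- from i+1 to j-1, no entry is attacked by i, hence none lies in the column of i;
-- and an entry k+1 can be at most one column left of k, since otherwise k ∉ D(T₀)
-- and the source property puts k+1 immediately left of k. So the entries of
-- [i+1, j-1] never cross the column of i.

module _ {p} {P : Pred ℕ p} (P? : Decidable P) (i : ℕ) where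

  FirstAbove : ℕ → Set p
  FirstAbove j = i < j × P j × (∀ m → i < m → m < j → ¬ P m)

  firstAbove-or-none : ∀ e → (∃[ j ] (j ≤ e × FirstAbove j)) ⊎ (∀ m → i < m → m ≤ e → ¬ P m)
  firstAbove-or-none zero = inj₂ λ m i<m m≤0 _ → n≮0 (<-≤-trans i<m m≤0)
  firstAbove-or-none (suc e) with firstAbove-or-none e
  ... | inj₁ (j , j≤e , first) = inj₁ (j , m≤n⇒m≤1+n j≤e , first)
  ... | inj₂ none with i <? suc e | P? (suc e)
  ...   | no i≮1+e | _       = inj₂ λ m i<m m≤1+e _ → i≮1+e (<-≤-trans i<m m≤1+e)
  ...   | yes i<1+e | yes Pe = inj₁ (suc e , ≤-refl , i<1+e , Pe , λ m i<m m<1+e → none m i<m (≤-pred m<1+e))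
  ...   | yes _ | no ¬Pe     = inj₂ none′
    where
    none′ : ∀ m → i < m → m ≤ suc e → ¬ P m
    none′ m i<m m≤1+e with m≤n⇒m<n∨m≡n m≤1+e
    ... | inj₁ m<1+e = none m i<m (≤-pred m<1+e)
    ... | inj₂ refl  = ¬Pe

  firstAbove : ∀ {e} → i < e → P e → ∃[ j ] (j ≤ e × FirstAbove j)
  firstAbove {e} i<e Pe with firstAbove-or-none e
  ... | inj₁ found = found
  ... | inj₂ none  = contradiction Pe (none e i<e ≤-refl)

CellAttacks? : ∀ r c r′ c′ → Dec (CellAttacks r c r′ c′)
CellAttacks? r c r′ c′ = (c ≟ c′ ×-dec ¬? (r ≟ r′)) ⊎-dec (suc c ≟ c′ ×-dec r <? r′)

InDiag-leftClosed : ∀ α {r c c′} → InDiag α r c′ → 1 ≤ c → c ≤ c′ → InDiag α r c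
InDiag-leftClosed _ (1≤r , r≤l , _ , c′≤len) 1≤c c≤c′ = 1≤r , r≤l , 1≤c , ≤-trans c≤c′ c′≤len

RowDecreasing : List ℕ → Tab → Set
RowDecreasing α T = ∀ r c → InDiag α r c → InDiag α r (suc c) → T r (suc c) < T r c

row-antitone : ∀ α T → RowDecreasing α T →
               ∀ {r c c′} → InDiag α r c → InDiag α r c′ → c < c′ → T r c′ < T r c
row-antitone α T decreasing {r} {c} {suc c′} d d′ c<1+c′ with m<1+n⇒m<n∨m≡n c<1+c′
... | inj₂ refl = decreasing r c d d′
... | inj₁ c<c′ = <-trans (decreasing r c′ d″ d′) (row-antitone α T decreasing d d″ c<c′)
  where
  d″ : InDiag α r c′
  d″ = InDiag-leftClosed α d′ (≤-trans (proj₁ (proj₂ (proj₂ d))) (<⇒≤ c<c′)) (n≤1+n c′)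

module Tableau (n : ℕ) (α : List ℕ) (T : Tab) (bij : IsBijection n α T) where

  Pos-unique : ∀ {a r c r′ c′} → Pos α T a r c → Pos α T a r′ c′ → r ≡ r′ × c ≡ c′
  Pos-unique (d , e) (d′ , e′) = proj₁ (proj₂ bij) _ _ _ _ d d′ (trans e (sym e′))

  Pos-bounds : ∀ {a r c} → Pos α T a r c → 1 ≤ a × a ≤ n
  Pos-bounds {r = r} {c} (d , refl) = proj₁ bij r c d

  Pos-exists : ∀ {a} → 1 ≤ a → a ≤ n → ∃[ r ] ∃[ c ] Pos α T a r c
  Pos-exists {a} = proj₂ (proj₂ bij) a

  Attacks⇒CellAttacks : ∀ {a b r c r′ c′} → Pos α T a r c → Pos α T b r′ c′ →
                        Attacks α T a b → CellAttacks r c r′ c′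
  Attacks⇒CellAttacks pa pb (_ , _ , _ , _ , pa′ , pb′ , att) with Pos-unique pa′ pa | Pos-unique pb′ pb
  ... | refl , refl | refl , refl = att

  sameColumn⇒Attacks : ∀ {a b r r′ c} → Pos α T a r c → Pos α T b r′ c → a ≢ b → Attacks α T a b
  sameColumn⇒Attacks {r = r} {r′} {c} pa pb a≢b = r , c , r′ , c , pa , pb , inj₁ (refl , r≢r′)
    where
    r≢r′ : r ≢ r′
    r≢r′ refl = a≢b (trans (sym (proj₂ pa)) (proj₂ pb))

  Attacks? : ∀ {a r c} → Pos α T a r c → Decidable (Attacks α T a)
  Attacks? {r = r} {c} pa b with 1 ≤? b | b ≤? n
  ... | no 1≰b | _ = no λ (_ , _ , _ , _ , _ , pb , _) → 1≰b (proj₁ (Pos-bounds pb))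
  ... | _ | no b≰n = no λ (_ , _ , _ , _ , _ , pb , _) → b≰n (proj₂ (Pos-bounds pb))
  ... | yes 1≤b | yes b≤n with Pos-exists 1≤b b≤n
  ...   | r′ , c′ , pb with CellAttacks? r c r′ c′
  ...     | yes att = yes (r , c , r′ , c′ , pa , pb , att)
  ...     | no ¬att = no (¬att ∘ Attacks⇒CellAttacks pa pb)

  ColLt-intro : ∀ {a b r c} → Pos α T a r c → (∀ {r′ c′} → Pos α T b r′ c′ → c < c′) → ColLt α T a b
  ColLt-intro pa right _ _ _ _ pa′ pb with Pos-unique pa pa′
  ... | refl , refl = right pb

  descent-attacks-above : RowDecreasing α T → ∀ {i r c r₁ c₁} →
    Pos α T i r c → Pos α T (suc i) r₁ c₁ → c ≤ c₁ → ∃[ e ] (i < e × e ≤ n × Attacks α T i e)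
  descent-attacks-above decreasing {i} {r} {c} {r₁} {c₁} pᵢ pᵢ₊₁ c≤c₁ with c ≟ c₁
  ... | yes refl = suc i , n<1+n i , proj₂ (Pos-bounds pᵢ₊₁) , sameColumn⇒Attacks pᵢ pᵢ₊₁ (<⇒≢ (n<1+n i))
  ... | no c≢c₁  = T r₁ c , i<e , proj₂ (Pos-bounds pₑ) , sameColumn⇒Attacks pᵢ pₑ (<⇒≢ i<e)
    where
    pₑ : Pos α T (T r₁ c) r₁ c
    pₑ = InDiag-leftClosed α (proj₁ pᵢ₊₁) (proj₁ (proj₂ (proj₂ (proj₁ pᵢ)))) c≤c₁ , refl
    i<e : i < T r₁ c
    i<e = <-trans (n<1+n i) (subst (_< T r₁ c) (proj₂ pᵢ₊₁)
                    (row-antitone α T decreasing (proj₁ pₑ) (proj₁ pᵢ₊₁) (≤∧≢⇒< c≤c₁ c≢c₁)))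

  source⇒column≤1+column-of-suc : SourceProp n α T → ∀ {k r c r′ c′} → 1 ≤ k →
    Pos α T k r c → Pos α T (suc k) r′ c′ → c ≤ suc c′
  source⇒column≤1+column-of-suc src {k} {r} {c} {r′} {c′} 1≤k pₖ pₖ₊₁ with c ≤? c′
  ... | yes c≤c′ = m≤n⇒m≤1+n c≤c′
  ... | no c≰c′ with src k 1≤k (∸-monoˡ-≤ 1 (proj₂ (Pos-bounds pₖ₊₁))) notDescent
    where
    notDescent : ¬ InD n α T k
    notDescent (_ , _ , _ , _ , _ , _ , pₖ′ , pₖ₊₁′ , le) with Pos-unique pₖ′ pₖ | Pos-unique pₖ₊₁′ pₖ₊₁
    ... | refl , refl | refl , refl = c≰c′ le
  ...   | _ , _ , pₖ₊₁′ , pₖ′ with Pos-unique pₖ₊₁′ pₖ₊₁ | Pos-unique pₖ′ pₖ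
  ...     | refl , refl | refl , refl = ≤-refl

  module _ (src : SourceProp n α T) {i r c r₁ c₁}
           (pᵢ : Pos α T i r c) (pᵢ₊₁ : Pos α T (suc i) r₁ c₁) (c≤c₁ : c ≤ c₁) where

    unattacked⇒rightOf : ∀ {m rₘ cₘ} → i < m → (∀ k → i < k → k ≤ m → ¬ Attacks α T i k) →
                         Pos α T m rₘ cₘ → c < cₘ
    unattacked⇒rightOf {suc m} {rₘ} {cₘ} i<1+m unattacked pₘ = ≤∧≢⇒< c≤cₘ c≢cₘ
      where
      c≢cₘ : c ≢ cₘ
      c≢cₘ refl = unattacked (suc m) i<1+m ≤-refl (sameColumn⇒Attacks pᵢ pₘ (<⇒≢ i<1+m))
      positive : i < m → 1 ≤ m
      positive i<m = ≤-trans (proj₁ (Pos-bounds pᵢ)) (<⇒≤ i<m)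
      m≤n : m ≤ n
      m≤n = ≤-trans (n≤1+n m) (proj₂ (Pos-bounds pₘ))
      unattacked′ : ∀ k → i < k → k ≤ m → ¬ Attacks α T i k
      unattacked′ k i<k k≤m = unattacked k i<k (m≤n⇒m≤1+n k≤m)
      c≤cₘ : c ≤ cₘ
      c≤cₘ with m<1+n⇒m<n∨m≡n i<1+m
      ... | inj₂ refl = subst (c ≤_) (proj₂ (Pos-unique pᵢ₊₁ pₘ)) c≤c₁
      ... | inj₁ i<m with Pos-exists (positive i<m) m≤n
      ...   | _ , _ , pₘ₋₁ = ≤-pred (<-≤-trans (unattacked⇒rightOf i<m unattacked′ pₘ₋₁)
                                              (source⇒column≤1+column-of-suc src (positive i<m) pₘ₋₁ pₘ))

lemma4p5 : (n : ℕ) (α : List ℕ) → IsComposition n α →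
    (T T₀ : Tab) → IsSCT n α T → IsSCT n α T₀ → Equiv α T T₀ → SourceProp n α T₀ →
    (i : ℕ) → InD n α T₀ i →
    ∃[ j ] (i < j × j ≤ n × Attacks α T₀ i j
      × (∀ k → i < k → k < j → ¬ Attacks α T₀ i k)
      × (∀ k → i < k → k < j → ColLt α T₀ i k))
lemma4p5 n α _ _ T₀ _ (bij , rows , _) _ src i (_ , _ , _ , _ , _ , _ , pᵢ , pᵢ₊₁ , c≤c₁)
  with Tableau.descent-attacks-above n α T₀ bij rows pᵢ pᵢ₊₁ c≤c₁
... | e , i<e , e≤n , attacks-e with firstAbove (Tableau.Attacks? n α T₀ bij pᵢ) i i<e attacks-e
... | j , j≤e , i<j , attacks-j , first =
  j , i<j , ≤-trans j≤e e≤n , attacks-j , first , rightOf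
  where
  open Tableau n α T₀ bij
  rightOf : ∀ k → i < k → k < j → ColLt α T₀ i k
  rightOf k i<k k<j = ColLt-intro pᵢ
    (unattacked⇒rightOf src pᵢ pᵢ₊₁ c≤c₁ i<k λ m i<m m≤k → first m i<m (≤-<-trans m≤k k<j))
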